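{- Let $n \ge 2$ and $i \ge 0$ be integers, let $P_n$ be the path with vertices $x_1, x_2, \ldots, x_n$ in order, and let $\mathcal{D}_{2^i} = \{2^i \delta_{x_1}, 2^i \delta_{x_n}\}$. Then $\rho(P_n, \mathcal{D}_{2^i}) = \pi(C_{n+2i-1})$.
   Context: Graphs are finite and undirected; $C_m$ denotes the cycle on $m$ vertices. A distribution is a function from the vertex set to $\mathbb{N}$ (numbers of pebbles); $\delta_v$ is the distribution with one pebble on $v$ and none elsewhere, and $t\delta_v$ has $t$ pebbles on $v$. A pebbling move removes two pebbles from a vertex and places one pebble on an adjacent vertex. $D'$ is reachable from $D$ if a sequence of pebbling moves leads from $D$ to a distribution $D''$ with $D''(v)\ge D'(v)$ for all $v$. The pebbling number $\pi(G)$ is the smallest $N$ such that for every vertex $v$, $\delta_v$ is reachable from every distribution with at least $N$ pebbles. For a set $\mathcal{S}$ of distributions, the target-selectable pebbling number $\rho(G,\mathcal{S})$ is the smallest $N$ such that from every distribution with at least $N$ pebbles on $G$, some distribution $D \in \mathcal{S}$ is reachable. -}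

module Defs where

open import Data.Nat using (ℕ; zero; suc; _+_; _*_; _∸_; _^_; _≤_; s≤s; z≤n)
open import Data.Fin using (Fin; toℕ; fromℕ; _≟_)
open import Data.List using (map; allFin)
open import Data.Nat.ListAction using (sum)
open import Data.Bool using (if_then_else_)
open import Data.Product using (Σ; ∃; _×_)
open import Data.Sum using (_⊎_)
open import Relation.Nullary using (¬_)
open import Relation.Nullary.Decidable using (⌊_⌋)
open import Relation.Binary.PropositionalEquality using (_≡_; _≗_)
open import Relation.Binary.Construct.Closure.ReflexiveTransitive using (Star)

Graph : ℕ → Set₁
Graph k = Fin k → Fin k → Set

-- Path P_n on vertices x_1..x_n, represented by Fin n (x_j ↦ j-1).
PathG : (n : ℕ) → Graph n
PathG n u v = suc (toℕ u) ≡ toℕ v ⊎ suc (toℕ v) ≡ toℕ u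

-- Cycle C_m on vertices 0..m-1: u ~ v iff u ≠ v and they are consecutive
-- modulo m.  (C_1 is a single vertex, C_2 a single edge.)
CycleG : (m : ℕ) → Graph m
CycleG m u v = ¬ (u ≡ v) × (Succ u v ⊎ Succ v u)
  where
  Succ : Fin m → Fin m → Set
  Succ a b = suc (toℕ a) ≡ toℕ b ⊎ (suc (toℕ a) ≡ m × toℕ b ≡ 0)

Dist : ℕ → Set
Dist k = Fin k → ℕ

size : ∀ {k} → Dist k → ℕ
size {k} D = sum (map D (allFin k))

δ : ∀ {k} → Fin k → Dist k
δ v w = if ⌊ w ≟ v ⌋ then 1 else 0

_·δ_ : ∀ {k} → ℕ → Fin k → Dist k
(t ·δ v) w = t * δ v w

move : ∀ {k} → Dist k → Fin k → Fin k → Dist k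
move D u v w =
  (D w ∸ (if ⌊ w ≟ u ⌋ then 2 else 0)) + (if ⌊ w ≟ v ⌋ then 1 else 0)

Step : ∀ {k} → Graph k → Dist k → Dist k → Set
Step {k} G D D' = Σ (Fin k) λ u → Σ (Fin k) λ v →
  G u v × 2 ≤ D u × D' ≗ move D u v

Reachable : ∀ {k} → Graph k → Dist k → Dist k → Set
Reachable {k} G D T = Σ (Dist k) λ D'' →
  Star (Step G) D D'' × (∀ v → T v ≤ D'' v)

PebProp : ∀ {k} → Graph k → ℕ → Set
PebProp {k} G N = (D : Dist k) → N ≤ size D → (v : Fin k) → Reachable G D (δ v)

TSProp : ∀ {k} → Graph k → (Dist k → Set) → ℕ → Set
TSProp {k} G S N = (D : Dist k) → N ≤ size D → ∃ λ T → S T × Reachable G D T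

IsLeast : (ℕ → Set) → ℕ → Set
IsLeast P N = P N × (∀ M → P M → N ≤ M)

IsPebblingNumber : ∀ {k} → Graph k → ℕ → Set
IsPebblingNumber G = IsLeast (PebProp G)

IsTSPebblingNumber : ∀ {k} → Graph k → (Dist k → Set) → ℕ → Set
IsTSPebblingNumber G S = IsLeast (TSProp G S)

firstV : ∀ {n} → 2 ≤ n → Fin n
firstV {suc k} _ = Data.Fin.zero

lastV : ∀ {n} → 2 ≤ n → Fin n
lastV {suc k} _ = fromℕ k

EndTargets : (n i : ℕ) → 2 ≤ n → Dist n → Set
EndTargets n i h T = T ≗ ((2 ^ i) ·δ firstV h) ⊎ T ≗ ((2 ^ i) ·δ lastV h)

module Submission where

-- Both numbers are computed through one notion, the end threshold of a
-- path.  On P_n the weights wFirst j = 2^(n-1-j) and wLast j = 2^j are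
-- potentials (a move never increases the weighted sum), and conversely a
-- greedy sweep reaches t pebbles on x₁ (resp. xₙ) whenever the potential
-- Φfirst (resp. Φlast) is at least t · 2^(n-1).  So ρ(P_n, D_{2^i}) is the
-- least N such that every distribution of N pebbles has one end potential
-- at least 2^i · 2^(n-1) (path-number).  For the cycle, reaching the root
-- of C_{m+1} amounts to bringing two pebbles to an end of the tail path
-- P_m, and rotation symmetry handles the other vertices, so π(C_{m+1}) is
-- the end threshold of P_m for t = 2 (cycle-number).  Finally the end
-- thresholds are computed: dividing the two weights of each vertex by 2^h
-- bounds the size of distributions poor towards both ends (scarce-count),
-- and a distribution on the middle vertices shows sharpness.  The values,
-- 2^(h+i) on P_{2h+1} and 2⌊2^(h+i+1)/3⌋ + 1 on P_{2h+2}, depend on n and i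
-- only through n + 2i, which gives the theorem.

open import Defs
open import Data.Nat using (ℕ; zero; suc; pred; NonZero; _+_; _*_; _∸_; _^_; _≤_; _<_; s≤s; z≤n; _≤?_; ⌊_/2⌋)
open import Data.Nat.Properties hiding (_≟_)
open import Data.Nat.Tactic.RingSolver using (solve-∀)
open import Data.Nat.ListAction using (sum)
open import Data.Fin using (Fin; toℕ; fromℕ; fromℕ<; inject₁; _≟_) renaming (zero to fz; suc to fs)
open import Data.Fin.Properties using (toℕ<n; toℕ-injective; toℕ-fromℕ; toℕ-inject₁; toℕ-fromℕ<)
open import Data.Fin.Induction using (<-weakInduction)
open import Data.List.Properties using (map-tabulate)
open import Data.Bool using (true; false; if_then_else_)
open import Data.Product using (Σ; _×_; _,_; proj₁; proj₂)
open import Data.Sum using (_⊎_; inj₁; inj₂)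
open import Data.Empty using (⊥-elim)
open import Relation.Nullary using (¬_; yes; no; contradiction)
open import Relation.Nullary.Decidable using (⌊_⌋)
open import Relation.Binary.PropositionalEquality
open import Relation.Binary.Construct.Closure.ReflexiveTransitive using (Star; ε; _◅_; _◅◅_)
open import Function using (_∘_; id)

_≤ᵖ_ : ∀ {k} → Dist k → Dist k → Set
D ≤ᵖ E = ∀ w → D w ≤ E w

move-mono : ∀ {k} {D E : Dist k} u v → D ≤ᵖ E → move D u v ≤ᵖ move E u v
move-mono u v D≤E w =
  +-monoˡ-≤ (if ⌊ w ≟ v ⌋ then 1 else 0) (∸-monoˡ-≤ (if ⌊ w ≟ u ⌋ then 2 else 0) (D≤E w))

replay : ∀ {k} {G : Graph k} {D E X : Dist k} → D ≤ᵖ E → Star (Step G) D X →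
  Σ (Dist k) λ X' → Star (Step G) E X' × X ≤ᵖ X'
replay {E = E} D≤E ε = E , ε , D≤E
replay {G = G} D≤E ((u , v , adj , two , eq) ◅ rest)
  with replay {G = G} (λ w → ≤-trans (≤-reflexive (eq w)) (move-mono u v D≤E w)) rest
... | X' , steps , X≤X' = X' , (u , v , adj , ≤-trans two (D≤E u) , λ _ → refl) ◅ steps , X≤X'

reach-refl : ∀ {k} {G : Graph k} {D T : Dist k} → T ≤ᵖ D → Reachable G D T
reach-refl {D = D} T≤D = D , ε , T≤D

reach-trans : ∀ {k} {G : Graph k} {D E F : Dist k} →
  Reachable G D E → Reachable G E F → Reachable G D F
reach-trans {G = G} (_ , steps₁ , E≤X) (_ , steps₂ , F≤Y) with replay {G = G} E≤X steps₂
... | Y' , steps₃ , Y≤Y' = Y' , steps₁ ◅◅ steps₃ , λ w → ≤-trans (F≤Y w) (Y≤Y' w)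

reach-step : ∀ {k} {G : Graph k} {D : Dist k} u v → G u v → 2 ≤ D u →
  Reachable G D (move D u v)
reach-step {D = D} u v adj two = move D u v , (u , v , adj , two , λ _ → refl) ◅ ε , λ _ → ≤-refl

reach-weaken : ∀ {k} {G : Graph k} {D T T' : Dist k} →
  Reachable G D T → T' ≤ᵖ T → Reachable G D T'
reach-weaken (X , steps , T≤X) T'≤T = X , steps , λ w → ≤-trans (T'≤T w) (T≤X w)

indicator-self : ∀ {n} (x : Fin n) → ⌊ x ≟ x ⌋ ≡ true
indicator-self x with x ≟ x
... | yes _ = refl
... | no x≢x = ⊥-elim (x≢x refl)

indicator-off : ∀ {n} (w u : Fin n) → ¬ (u ≡ w) → ⌊ w ≟ u ⌋ ≡ false
indicator-off w u u≢w with w ≟ u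
... | yes w≡u = ⊥-elim (u≢w (sym w≡u))
... | no _ = refl

indicator-inj : ∀ {a b} (e : Fin a → Fin b) → (∀ x y → e x ≡ e y → x ≡ y) →
  ∀ x y → ⌊ e x ≟ e y ⌋ ≡ ⌊ x ≟ y ⌋
indicator-inj e inj x y with x ≟ y | e x ≟ e y
... | yes _ | yes _ = refl
... | no _ | no _ = refl
... | yes x≡y | no ex≢ey = ⊥-elim (ex≢ey (cong e x≡y))
... | no x≢y | yes ex≡ey = ⊥-elim (x≢y (inj x y ex≡ey))

fs-injective : ∀ {n} (x y : Fin n) → fs x ≡ fs y → x ≡ y
fs-injective x y refl = refl

δ-self : ∀ {n} (x : Fin n) → δ x x ≡ 1
δ-self x rewrite indicator-self x = refl

δ-fs : ∀ {n} (v x : Fin n) → δ (fs v) (fs x) ≡ δ v x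
δ-fs v x = cong (λ b → if b then 1 else 0) (indicator-inj fs fs-injective x v)

δ-below : ∀ {k} (v : Fin k) (F : Dist k) → 1 ≤ F v → δ v ≤ᵖ F
δ-below v F le w with w ≟ v
... | yes refl = le
... | no _ = z≤n

·δ-mono : ∀ {n} (v : Fin n) {t t'} → t ≤ t' → (t ·δ v) ≤ᵖ (t' ·δ v)
·δ-mono v t≤t' w = *-monoˡ-≤ (δ v w) t≤t'

transport : ∀ {a b} {G : Graph a} {H : Graph b} (e : Fin a → Fin b) →
  (∀ x y → G x y → H (e x) (e y)) → (∀ x y → e x ≡ e y → x ≡ y) →
  ∀ {E X : Dist a} (D : Dist b) → Star (Step G) E X → E ≤ᵖ (D ∘ e) →
  Σ (Dist b) λ D' → Star (Step H) D D' × X ≤ᵖ (D' ∘ e)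
     × (∀ w → (∀ j → ¬ (e j ≡ w)) → D w ≤ D' w)
transport e hom inj D ε E≤D = D , ε , E≤D , λ _ _ → ≤-refl
transport {G = G} {H} e hom inj {E} D (_◅_ {j = E'} (u , v , adj , two , eq) rest) E≤D
  with transport {G = G} {H} e hom inj (move D (e u) (e v)) rest E'≤moved
  where
  E'≤moved : E' ≤ᵖ (move D (e u) (e v) ∘ e)
  E'≤moved j rewrite eq j | indicator-inj e inj j u | indicator-inj e inj j v =
    +-monoˡ-≤ (if ⌊ j ≟ v ⌋ then 1 else 0) (∸-monoˡ-≤ (if ⌊ j ≟ u ⌋ then 2 else 0) (E≤D j))
... | D' , steps , X≤D' , outside =
  D' , (e u , e v , hom u v adj , ≤-trans two (E≤D u) , λ _ → refl) ◅ steps , X≤D' ,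
  λ w w∉e → ≤-trans (untouched w w∉e) (outside w w∉e)
  where
  untouched : ∀ w → (∀ j → ¬ (e j ≡ w)) → D w ≤ move D (e u) (e v) w
  untouched w w∉e rewrite indicator-off w (e u) (w∉e u) | indicator-off w (e v) (w∉e v) =
    ≤-reflexive (sym (+-identityʳ (D w)))

wsum : ∀ {n} → Dist n → (Fin n → ℕ) → ℕ
wsum {zero} D w = 0
wsum {suc n} D w = D fz * w fz + wsum (D ∘ fs) (w ∘ fs)

size-suc : ∀ {n} (D : Dist (suc n)) → size D ≡ D fz + size (D ∘ fs)
size-suc {n} D = cong (λ xs → D fz + sum xs)
  (trans (map-tabulate fs D) (sym (map-tabulate id (D ∘ fs))))

size-wsum : ∀ {n} (D : Dist n) → size D ≡ wsum D (λ _ → 1)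
size-wsum {zero} D = refl
size-wsum {suc n} D = trans (size-suc D)
  (cong₂ _+_ (sym (*-identityʳ (D fz))) (size-wsum (D ∘ fs)))

wsum-cong : ∀ {n} {D E : Dist n} w → D ≗ E → wsum D w ≡ wsum E w
wsum-cong {zero} w D≗E = refl
wsum-cong {suc n} w D≗E = cong₂ _+_ (cong (_* w fz) (D≗E fz)) (wsum-cong (w ∘ fs) (D≗E ∘ fs))

wsum-monoʷ : ∀ {n} (D : Dist n) {w w' : Fin n → ℕ} → (∀ j → w j ≤ w' j) → wsum D w ≤ wsum D w'
wsum-monoʷ {zero} D w≤w' = z≤n
wsum-monoʷ {suc n} D w≤w' =
  +-mono-≤ (*-monoʳ-≤ (D fz) (w≤w' fz)) (wsum-monoʷ (D ∘ fs) (w≤w' ∘ fs))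

*-comm-left : ∀ a b c → a * (b * c) ≡ b * (a * c)
*-comm-left = solve-∀

private
  interchange : ∀ a b c d → (a + b) + (c + d) ≡ (a + c) + (b + d)
  interchange = solve-∀

wsum-+ᵈ : ∀ {n} (D E : Dist n) w → wsum (λ j → D j + E j) w ≡ wsum D w + wsum E w
wsum-+ᵈ {zero} D E w = refl
wsum-+ᵈ {suc n} D E w =
  trans (cong₂ _+_ (*-distribʳ-+ (w fz) (D fz) (E fz)) (wsum-+ᵈ (D ∘ fs) (E ∘ fs) (w ∘ fs)))
        (interchange (D fz * w fz) (E fz * w fz) (wsum (D ∘ fs) (w ∘ fs)) (wsum (E ∘ fs) (w ∘ fs)))

wsum-+ʷ : ∀ {n} (D : Dist n) w w' → wsum D (λ j → w j + w' j) ≡ wsum D w + wsum D w'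
wsum-+ʷ {zero} D w w' = refl
wsum-+ʷ {suc n} D w w' =
  trans (cong₂ _+_ (*-distribˡ-+ (D fz) (w fz) (w' fz)) (wsum-+ʷ (D ∘ fs) (w ∘ fs) (w' ∘ fs)))
        (interchange (D fz * w fz) (D fz * w' fz) (wsum (D ∘ fs) (w ∘ fs)) (wsum (D ∘ fs) (w' ∘ fs)))

wsum-scale : ∀ {n} (D : Dist n) c w → wsum D (λ j → c * w j) ≡ c * wsum D w
wsum-scale {zero} D c w = sym (*-zeroʳ c)
wsum-scale {suc n} D c w =
  trans (cong₂ _+_ (*-comm-left (D fz) c (w fz)) (wsum-scale (D ∘ fs) c (w ∘ fs)))
        (sym (*-distribˡ-+ c (D fz * w fz) (wsum (D ∘ fs) (w ∘ fs))))

wsum-term : ∀ {n} (D : Dist n) w j → D j * w j ≤ wsum D w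
wsum-term {suc n} D w fz = m≤m+n _ _
wsum-term {suc n} D w (fs j) = m≤n⇒m≤o+n (D fz * w fz) (wsum-term (D ∘ fs) (w ∘ fs) j)

wsum-δ : ∀ {n} c (v : Fin n) w → wsum (c ·δ v) w ≡ c * w v
wsum-δ {suc n} c fz w =
  trans (cong₂ _+_ (cong (_* w fz) (*-identityʳ c)) (empty (w ∘ fs) (λ _ → *-zeroʳ c)))
        (+-identityʳ _)
  where
  empty : ∀ {m} {E : Dist m} w' → (∀ j → E j ≡ 0) → wsum E w' ≡ 0
  empty {zero} w' E≡0 = refl
  empty {suc m} w' E≡0 rewrite E≡0 fz = empty (w' ∘ fs) (E≡0 ∘ fs)
wsum-δ {suc n} c (fs v) w =
  trans (cong (_+ wsum (λ x → (c ·δ fs v) (fs x)) (w ∘ fs)) (cong (_* w fz) (*-zeroʳ c)))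
        (trans (wsum-cong (w ∘ fs) (λ x → cong (c *_) (δ-fs v x))) (wsum-δ c v (w ∘ fs)))

pebbles-weight : ∀ {n} (E : Dist n) w j {c} → c ≤ E j → c * w j ≤ wsum E w
pebbles-weight E w j c≤E = ≤-trans (*-monoˡ-≤ (w j) c≤E) (wsum-term E w j)

wsum-move : ∀ {n} (D : Dist n) u v w → 2 ≤ D u →
  wsum (move D u v) w + 2 * w u ≡ wsum D w + w v
wsum-move D u v w two = begin
  wsum (move D u v) w + 2 * w u         ≡⟨ cong (wsum (move D u v) w +_) (sym (wsum-δ 2 u w)) ⟩
  wsum (move D u v) w + wsum (2 ·δ u) w ≡⟨ sym (wsum-+ᵈ (move D u v) (2 ·δ u) w) ⟩
  wsum (λ j → move D u v j + 2 * δ u j) w ≡⟨ wsum-cong w pointwise ⟩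
  wsum (λ j → D j + 1 * δ v j) w        ≡⟨ wsum-+ᵈ D (1 ·δ v) w ⟩
  wsum D w + wsum (1 ·δ v) w            ≡⟨ cong (wsum D w +_) (trans (wsum-δ 1 v w) (+-identityʳ _)) ⟩
  wsum D w + w v                        ∎
  where
  open ≡-Reasoning
  pointwise : ∀ j → move D u v j + 2 * δ u j ≡ D j + 1 * δ v j
  pointwise j with j ≟ u
  ... | yes refl = shuffle (D j) (if ⌊ j ≟ v ⌋ then 1 else 0) two
    where
    shuffle : ∀ x b → 2 ≤ x → (x ∸ 2) + b + 2 * 1 ≡ x + 1 * b
    shuffle x b 2≤x = begin
      (x ∸ 2) + b + 2   ≡⟨ +-comm ((x ∸ 2) + b) 2 ⟩
      2 + ((x ∸ 2) + b) ≡⟨ sym (+-assoc 2 (x ∸ 2) b) ⟩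
      2 + (x ∸ 2) + b   ≡⟨ cong (_+ b) (m+[n∸m]≡n 2≤x) ⟩
      x + b             ≡⟨ cong (x +_) (sym (*-identityˡ b)) ⟩
      x + 1 * b         ∎
  ... | no _ = trans (+-identityʳ _) (cong (D j +_) (sym (*-identityˡ _)))

-- A weight w is a potential for G when it at most doubles along every
-- edge u — v.  A move u → v then costs 2 w u and gains only w v, so the
-- weighted sum never increases.
Potential : ∀ {k} → Graph k → (Fin k → ℕ) → Set
Potential G w = ∀ u v → G u v → w v ≤ 2 * w u

potential-move : ∀ {k} (D : Dist k) u v w → w v ≤ 2 * w u → 2 ≤ D u →
  wsum (move D u v) w ≤ wsum D w
potential-move D u v w grows two = +-cancelʳ-≤ (2 * w u) _ _ (begin
  wsum (move D u v) w + 2 * w u ≡⟨ wsum-move D u v w two ⟩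
  wsum D w + w v                ≤⟨ +-monoʳ-≤ (wsum D w) grows ⟩
  wsum D w + 2 * w u            ∎)
  where open ≤-Reasoning

potential-star : ∀ {k} {G : Graph k} {w} → Potential G w →
  ∀ {D X} → Star (Step G) D X → wsum X w ≤ wsum D w
potential-star pot ε = ≤-refl
potential-star {w = w} pot {D} ((u , v , adj , two , eq) ◅ steps) =
  ≤-trans (potential-star pot steps)
          (≤-trans (≤-reflexive (wsum-cong w eq)) (potential-move D u v w (pot u v adj) two))

potential-bound : ∀ {k} {G : Graph k} {w} → Potential G w →
  ∀ {D} t v → Reachable G D (t ·δ v) → t * w v ≤ wsum D w
potential-bound {w = w} pot t v (X , steps , T≤X) =
  ≤-trans (pebbles-weight X w v t≤X) (potential-star pot steps)
  where
  t≤X : t ≤ X v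
  t≤X = ≤-trans (≤-reflexive (sym (trans (cong (t *_) (δ-self v)) (*-identityʳ t)))) (T≤X v)

-- The two potentials of the path P_n = x₁ … xₙ (vertex j of Fin n is
-- x_{j+1}): wFirst n j = 2^(n-1-j) values pebbles by their use for x₁,
-- wLast n j = 2^j by their use for xₙ.
wFirst : ∀ n → Fin n → ℕ
wFirst (suc n) fz = 2 ^ n
wFirst (suc n) (fs j) = wFirst n j

wLast : ∀ n → Fin n → ℕ
wLast (suc n) fz = 1
wLast (suc n) (fs j) = 2 * wLast n j

Φfirst Φlast : ∀ {n} → Dist n → ℕ
Φfirst {n} D = wsum D (wFirst n)
Φlast {n} D = wsum D (wLast n)

wFirst-pow : ∀ n (j : Fin (suc n)) → wFirst (suc n) j ≡ 2 ^ (n ∸ toℕ j)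
wFirst-pow n fz = refl
wFirst-pow (suc n) (fs j) = wFirst-pow n j

wLast-pow : ∀ n (j : Fin n) → wLast n j ≡ 2 ^ toℕ j
wLast-pow (suc n) fz = refl
wLast-pow (suc n) (fs j) = cong (2 *_) (wLast-pow n j)

wFirst-halves : ∀ n (u v : Fin n) → suc (toℕ u) ≡ toℕ v → 2 * wFirst n v ≡ wFirst n u
wFirst-halves (suc (suc n)) fz (fs fz) _ = refl
wFirst-halves (suc n) (fs u) (fs v) eq = wFirst-halves n u v (suc-injective eq)

wLast-doubles : ∀ n (u v : Fin n) → suc (toℕ u) ≡ toℕ v → wLast n v ≡ 2 * wLast n u
wLast-doubles (suc (suc n)) fz (fs fz) _ = refl
wLast-doubles (suc n) (fs u) (fs v) eq = cong (2 *_) (wLast-doubles n u v (suc-injective eq))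

wFirst-potential : ∀ n → Potential (PathG n) (wFirst n)
wFirst-potential n u v (inj₁ u→v) = begin
  wFirst n v     ≤⟨ m≤n*m (wFirst n v) 2 ⟩
  2 * wFirst n v ≡⟨ wFirst-halves n u v u→v ⟩
  wFirst n u     ≤⟨ m≤n*m (wFirst n u) 2 ⟩
  2 * wFirst n u ∎
  where open ≤-Reasoning
wFirst-potential n u v (inj₂ v→u) = ≤-reflexive (sym (wFirst-halves n v u v→u))

wLast-potential : ∀ n → Potential (PathG n) (wLast n)
wLast-potential n u v (inj₁ u→v) = ≤-reflexive (wLast-doubles n u v u→v)
wLast-potential n u v (inj₂ v→u) = begin
  wLast n v     ≤⟨ m≤n*m (wLast n v) 2 ⟩
  2 * wLast n v ≡⟨ sym (wLast-doubles n v u v→u) ⟩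
  wLast n u     ≤⟨ m≤n*m (wLast n u) 2 ⟩
  2 * wLast n u ∎
  where open ≤-Reasoning

first-weight : ∀ m (j : Fin m) → toℕ j ≡ 0 → wFirst m j ≡ 2 ^ (m ∸ 1)
first-weight (suc m) fz _ = refl

last-weight : ∀ m (j : Fin m) → suc (toℕ j) ≡ m → wLast m j ≡ 2 ^ (m ∸ 1)
last-weight m j j-last = trans (wLast-pow m j) (cong (λ k → 2 ^ (k ∸ 1)) j-last)

·δ-below : ∀ {k} (v : Fin k) (F : Dist k) {t} → t ≤ F v → (t ·δ v) ≤ᵖ F
·δ-below v F {t} t≤F w with w ≟ v
... | yes refl = ≤-trans (≤-reflexive (*-identityʳ t)) t≤F
... | no _ = ≤-trans (≤-reflexive (*-zeroʳ t)) z≤n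

path-shift : ∀ n (x y : Fin n) → PathG n x y → PathG (suc n) (fs x) (fs y)
path-shift n x y (inj₁ x→y) = inj₁ (cong suc x→y)
path-shift n x y (inj₂ y→x) = inj₂ (cong suc y→x)

lift-tail : ∀ {n} (F : Dist (suc n)) {X : Dist n} → Reachable (PathG n) (F ∘ fs) X →
  Σ (Dist (suc n)) λ F' → Star (Step (PathG (suc n))) F F' × X ≤ᵖ (F' ∘ fs) × F fz ≤ F' fz
lift-tail {n} F (Y , steps , X≤Y)
  with transport {G = PathG n} fs (path-shift n) fs-injective F steps (λ _ → ≤-refl)
... | F' , steps' , Y≤F' , outside =
  F' , steps' , (λ w → ≤-trans (X≤Y w) (Y≤F' w)) , outside fz (λ _ ())

double-suc : ∀ c → 2 + 2 * c ≡ 2 * suc c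
double-suc = solve-∀

gather-first : ∀ {n} c (F : Dist (suc (suc n))) → 2 * c ≤ F (fs fz) →
  Reachable (PathG (suc (suc n))) F ((F fz + c) ·δ fz)
gather-first zero F _ = reach-refl (·δ-below fz F (≤-reflexive (+-identityʳ (F fz))))
gather-first (suc c) F 2c≤F =
  reach-trans (reach-step (fs fz) fz (inj₂ refl) two)
    (reach-weaken (gather-first c (move F (fs fz) fz) rest)
                  (·δ-mono fz (≤-reflexive (sym (+-assoc (F fz) 1 c)))))
  where
  2c+2≤F : 2 + 2 * c ≤ F (fs fz)
  2c+2≤F = ≤-trans (≤-reflexive (double-suc c)) 2c≤F
  two : 2 ≤ F (fs fz)
  two = ≤-trans (m≤m+n 2 (2 * c)) 2c+2≤F
  rest : 2 * c ≤ move F (fs fz) fz (fs fz)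
  rest = ≤-trans (∸-monoˡ-≤ 2 2c+2≤F) (m≤m+n _ 0)

-- The deficit t - a on x₁ must be covered by the tail, which therefore
-- has to deliver 2 (t - a) pebbles to x₂.
deficit-bound : ∀ t a p W → t * (2 * p) ≤ a * (2 * p) + W → (2 * (t ∸ a)) * p ≤ W
deficit-bound t a p W le = ≤-trans
  (≤-reflexive (trans (reassoc (t ∸ a) p) (*-distribʳ-∸ (2 * p) t a)))
  (m≤n+o⇒m∸n≤o (t * (2 * p)) (a * (2 * p)) le)
  where
  reassoc : ∀ x p → (2 * x) * p ≡ x * (2 * p)
  reassoc = solve-∀

-- Sufficiency for the first vertex: t pebbles reach x₁ as soon as
-- t · 2^(n-1) ≤ Φfirst D.  Induction on n: the tail supplies the deficit.
reach-first : ∀ n (D : Dist (suc n)) t → t * 2 ^ n ≤ Φfirst D →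
  Reachable (PathG (suc n)) D (t ·δ fz)
reach-first zero D t le =
  reach-refl (·δ-below fz D (*-cancelʳ-≤ t (D fz) 1 (≤-trans le (≤-reflexive (+-identityʳ _)))))
reach-first (suc n) D t le
  with lift-tail D (reach-first n (D ∘ fs) (2 * (t ∸ D fz)) (deficit-bound t (D fz) (2 ^ n) _ le))
... | D₁ , steps , tail≤D₁ , D≤D₁ =
  reach-weaken (reach-trans (D₁ , steps , λ _ → ≤-refl) (gather-first (t ∸ D fz) D₁ onSecond))
               (·δ-mono fz (≤-trans (m≤n+m∸n t (D fz)) (+-monoˡ-≤ (t ∸ D fz) D≤D₁)))
  where
  onSecond : 2 * (t ∸ D fz) ≤ D₁ (fs fz)
  onSecond = ≤-trans (≤-reflexive (sym (*-identityʳ _))) (tail≤D₁ fz)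

pushed : ∀ {n} → Dist (suc (suc n)) → ℕ → Dist (suc (suc n))
pushed D c fz = 0
pushed D c (fs fz) = D (fs fz) + c
pushed D c (fs (fs j)) = D (fs (fs j))

push-second : ∀ {n} c (D : Dist (suc (suc n))) → 2 * c ≤ D fz →
  Reachable (PathG (suc (suc n))) D (pushed D c)
push-second zero D _ =
  reach-refl λ { fz → z≤n ; (fs fz) → ≤-reflexive (+-identityʳ _) ; (fs (fs j)) → ≤-refl }
push-second (suc c) D 2c≤D =
  reach-trans (reach-step fz (fs fz) (inj₁ refl) two)
    (reach-weaken (push-second c (move D fz (fs fz)) rest)
       λ { fz → z≤n
         ; (fs fz) → ≤-reflexive (sym (+-assoc (D (fs fz)) 1 c))
         ; (fs (fs j)) → m≤m+n _ 0 })
  where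
  2c+2≤D : 2 + 2 * c ≤ D fz
  2c+2≤D = ≤-trans (≤-reflexive (double-suc c)) 2c≤D
  two : 2 ≤ D fz
  two = ≤-trans (m≤m+n 2 (2 * c)) 2c+2≤D
  rest : 2 * c ≤ move D fz (fs fz) fz
  rest = ≤-trans (∸-monoˡ-≤ 2 2c+2≤D) (m≤m+n _ 0)

half-le : ∀ a → 2 * ⌊ a /2⌋ ≤ a
half-le zero = z≤n
half-le (suc zero) = z≤n
half-le (suc (suc a)) = ≤-trans (≤-reflexive (sym (double-suc ⌊ a /2⌋))) (s≤s (s≤s (half-le a)))

half-ge : ∀ a → a ≤ suc (2 * ⌊ a /2⌋)
half-ge zero = z≤n
half-ge (suc zero) = s≤s z≤n
half-ge (suc (suc a)) = ≤-trans (s≤s (s≤s (half-ge a))) (≤-reflexive (cong suc (double-suc ⌊ a /2⌋)))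

-- Halving the pebbles of x₁ loses at most one unit of Φlast.
halving-bound : ∀ x a W → 2 * x ≤ a + 2 * W → x ≤ ⌊ a /2⌋ + W
halving-bound x a W le = ≤-pred (*-cancelˡ-< 2 x (suc (⌊ a /2⌋ + W)) (begin-strict
  2 * x                     ≤⟨ le ⟩
  a + 2 * W                 ≤⟨ +-monoˡ-≤ (2 * W) (half-ge a) ⟩
  suc (2 * ⌊ a /2⌋) + 2 * W ≡⟨ regroup ⌊ a /2⌋ W ⟩
  suc (2 * (⌊ a /2⌋ + W))   <⟨ n<1+n _ ⟩
  2 + 2 * (⌊ a /2⌋ + W)     ≡⟨ double-suc (⌊ a /2⌋ + W) ⟩
  2 * suc (⌊ a /2⌋ + W)     ∎))
  where
  open ≤-Reasoning
  regroup : ∀ h W → suc (2 * h) + 2 * W ≡ suc (2 * (h + W))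
  regroup = solve-∀

-- Sufficiency for the last vertex: t pebbles reach xₙ as soon as
-- t · 2^(n-1) ≤ Φlast D.  Push half of x₁ onto x₂, then recurse on the tail.
reach-last : ∀ n (D : Dist (suc n)) t → t * 2 ^ n ≤ Φlast D →
  Reachable (PathG (suc n)) D (t ·δ fromℕ n)
reach-last zero D t le =
  reach-refl (·δ-below fz D (*-cancelʳ-≤ t (D fz) 1 (≤-trans le (≤-reflexive (+-identityʳ _)))))
reach-last (suc n) D t le with lift-tail T (reach-last n (T ∘ fs) t tail-enough)
  where
  T : Dist (suc (suc n))
  T = pushed D ⌊ D fz /2⌋
  tail-enough : t * 2 ^ n ≤ Φlast (T ∘ fs)
  tail-enough = ≤-trans (halving-bound (t * 2 ^ n) (D fz) (Φlast (D ∘ fs)) (begin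
    2 * (t * 2 ^ n)              ≡⟨ *-comm-left 2 t (2 ^ n) ⟩
    t * 2 ^ suc n                ≤⟨ le ⟩
    Φlast D                      ≡⟨ cong (D fz * 1 +_) (wsum-scale (D ∘ fs) 2 (wLast (suc n))) ⟩
    D fz * 1 + 2 * Φlast (D ∘ fs) ≡⟨ cong (_+ 2 * Φlast (D ∘ fs)) (*-identityʳ (D fz)) ⟩
    D fz + 2 * Φlast (D ∘ fs)    ∎))
    (≤-reflexive (regroup (D (fs fz)) ⌊ D fz /2⌋ (wsum (D ∘ fs ∘ fs) (wLast (suc n) ∘ fs))))
    where
    open ≤-Reasoning
    regroup : ∀ x c r → c + (x * 1 + r) ≡ (x + c) * 1 + r
    regroup = solve-∀
... | T₁ , steps , tail≤T₁ , _ =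
  reach-trans (push-second ⌊ D fz /2⌋ D (half-le (D fz)))
    (T₁ , steps , λ { fz → ≤-trans (≤-reflexive (*-zeroʳ t)) z≤n
                    ; (fs x) → ≤-trans (≤-reflexive (cong (t *_) (δ-fs (fromℕ n) x))) (tail≤T₁ x) })

EndUpper : ℕ → ℕ → ℕ → Set
EndUpper n t N = (E : Dist n) → N ≤ size E →
  t * 2 ^ (n ∸ 1) ≤ Φfirst E ⊎ t * 2 ^ (n ∸ 1) ≤ Φlast E

EndWitness : ℕ → ℕ → ℕ → Set
EndWitness n t N = Σ (Dist n) λ E → suc (size E) ≡ N ×
  Φfirst E < t * 2 ^ (n ∸ 1) × Φlast E < t * 2 ^ (n ∸ 1)

EndThreshold : ℕ → ℕ → ℕ → Set
EndThreshold n t N = EndUpper n t N × EndWitness n t N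

below-witness : ∀ {k} {Good : Dist k → Set} {N M} (E : Dist k) → suc (size E) ≡ N →
  ¬ Good E → ((D : Dist k) → M ≤ size D → Good D) → N ≤ M
below-witness {N = N} {M} E sizeE bad enough with N ≤? M
... | yes N≤M = N≤M
... | no N≰M = ⊥-elim (bad (enough E (≤-pred (≤-trans (≰⇒> N≰M) (≤-reflexive (sym sizeE))))))

-- Path part of the theorem: by the potential characterisation of
-- reachability at the ends, the end threshold for t = 2^i is
-- ρ(P_n, D_{2^i}).
path-number : ∀ n₀ i (h : 2 ≤ suc n₀) {N} → EndThreshold (suc n₀) (2 ^ i) N →
  IsTSPebblingNumber (PathG (suc n₀)) (EndTargets (suc n₀) i h) N
path-number n₀ i h {N} (upper , E , sizeE , firstE , lastE) = sufficient , minimal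
  where
  sufficient : TSProp (PathG (suc n₀)) (EndTargets (suc n₀) i h) N
  sufficient D N≤D with upper D N≤D
  ... | inj₁ first = _ , inj₁ (λ _ → refl) , reach-first n₀ D (2 ^ i) first
  ... | inj₂ last = _ , inj₂ (λ _ → refl) , reach-last n₀ D (2 ^ i) last
  unreachable : ¬ (Σ (Dist (suc n₀)) λ T → EndTargets (suc n₀) i h T × Reachable (PathG (suc n₀)) E T)
  unreachable (T , inj₁ T≗ , reach) =
    <⇒≱ firstE (potential-bound (wFirst-potential (suc n₀)) (2 ^ i) fz
                  (reach-weaken reach (≤-reflexive ∘ sym ∘ T≗)))
  unreachable (T , inj₂ T≗ , reach) =
    <⇒≱ lastE (≤-trans (≤-reflexive (cong (2 ^ i *_) (sym last-end)))
                 (potential-bound (wLast-potential (suc n₀)) (2 ^ i) (fromℕ n₀)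
                   (reach-weaken reach (≤-reflexive ∘ sym ∘ T≗))))
    where
    last-end : wLast (suc n₀) (fromℕ n₀) ≡ 2 ^ n₀
    last-end = last-weight (suc n₀) (fromℕ n₀) (cong suc (toℕ-fromℕ n₀))
  minimal : ∀ M → TSProp (PathG (suc n₀)) (EndTargets (suc n₀) i h) M → N ≤ M
  minimal M enough = below-witness E sizeE unreachable enough

Next : (m : ℕ) → Fin m → Fin m → Set
Next m a b = suc (toℕ a) ≡ toℕ b ⊎ (suc (toℕ a) ≡ m × toℕ b ≡ 0)

-- Seen from its vertex 0 (the root), C_{m+1} is the root together with
-- the path P_m on the vertices 1 … m, whose two ends are the root's
-- neighbours.
path-in-cycle : ∀ m (x y : Fin m) → PathG m x y → CycleG (suc m) (fs x) (fs y)
path-in-cycle m x y (inj₁ x→y) = (λ { refl → 1+n≢n x→y }) , inj₁ (inj₁ (cong suc x→y))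
path-in-cycle m x y (inj₂ y→x) = (λ { refl → 1+n≢n y→x }) , inj₂ (inj₁ (cong suc y→x))

cycle-to-path : ∀ m (j l : Fin m) → CycleG (suc m) (fs j) (fs l) → PathG m j l
cycle-to-path m j l (_ , inj₁ (inj₁ j→l)) = inj₁ (suc-injective j→l)
cycle-to-path m j l (_ , inj₂ (inj₁ l→j)) = inj₂ (suc-injective l→j)
cycle-to-path m j l (_ , inj₁ (inj₂ (_ , ())))
cycle-to-path m j l (_ , inj₂ (inj₂ (_ , ())))

root-neighbour : ∀ m (j : Fin m) → CycleG (suc m) (fs j) fz → toℕ j ≡ 0 ⊎ suc (toℕ j) ≡ m
root-neighbour m j (_ , inj₁ (inj₁ ()))
root-neighbour m j (_ , inj₁ (inj₂ (j-last , _))) = inj₂ (suc-injective j-last)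
root-neighbour m j (_ , inj₂ (inj₁ j-first)) = inj₁ (sym (suc-injective j-first))
root-neighbour m j (_ , inj₂ (inj₂ (_ , ())))

via-neighbour : ∀ m (D : Dist (suc m)) j → CycleG (suc m) (fs j) fz →
  Reachable (PathG m) (D ∘ fs) (2 ·δ j) → Reachable (CycleG (suc m)) D (δ fz)
via-neighbour m D j adj (X , steps , T≤X)
  with transport {G = PathG m} fs (path-in-cycle m) fs-injective D steps (λ _ → ≤-refl)
... | D₁ , steps₁ , X≤D₁ , _ =
  reach-trans (D₁ , steps₁ , λ _ → ≤-refl)
    (reach-weaken (reach-step (fs j) fz adj two) (δ-below fz _ (m≤n+m 1 _)))
  where
  two : 2 ≤ D₁ (fs j)
  two = ≤-trans (≤-reflexive (sym (cong (2 *_) (δ-self j)))) (≤-trans (T≤X j) (X≤D₁ j))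

tail-to-root : ∀ m {N} → 1 ≤ N → EndUpper m 2 N →
  (D : Dist (suc m)) → N ≤ size (D ∘ fs) → Reachable (CycleG (suc m)) D (δ fz)
tail-to-root zero N≥1 _ D N≤0 = ⊥-elim (1+n≰n (≤-trans N≥1 N≤0))
tail-to-root (suc m₀) _ upper D N≤tail with upper (D ∘ fs) N≤tail
... | inj₁ first = via-neighbour (suc m₀) D fz ((λ ()) , inj₂ (inj₁ refl))
                     (reach-first m₀ (D ∘ fs) 2 first)
... | inj₂ last = via-neighbour (suc m₀) D (fromℕ m₀)
                    ((λ ()) , inj₁ (inj₂ (cong (suc ∘ suc) (toℕ-fromℕ m₀) , refl)))
                    (reach-last m₀ (D ∘ fs) 2 last)

root-reachable : ∀ m {N} → 1 ≤ N → EndUpper m 2 N →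
  ∀ D → N ≤ size D → Reachable (CycleG (suc m)) D (δ fz)
root-reachable m N≥1 upper D N≤D with 1 ≤? D fz
... | yes one = reach-refl (δ-below fz D one)
... | no none = tail-to-root m N≥1 upper D (≤-trans N≤D (≤-reflexive root-empty))
  where
  root-empty : size D ≡ size (D ∘ fs)
  root-empty = trans (size-suc D) (cong (_+ size (D ∘ fs)) (n<1⇒n≡0 (≰⇒> none)))

-- Distributions with an empty root whose tail has potential below 2 · 2^(m-1)
-- towards both ends: no move leaves this set, so the root stays empty.
Starved : ∀ m → Dist (suc m) → Set
Starved m D = D fz ≡ 0 × Φfirst (D ∘ fs) < 2 * 2 ^ (m ∸ 1) × Φlast (D ∘ fs) < 2 * 2 ^ (m ∸ 1)

tail-move : ∀ {m} {D D' : Dist (suc m)} j l → D' ≗ move D (fs j) (fs l) →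
  (D' ∘ fs) ≗ move (D ∘ fs) j l
tail-move {D = D} j l eq x = trans (eq (fs x))
  (cong₂ (λ a b → (D (fs x) ∸ (if a then 2 else 0)) + (if b then 1 else 0))
         (indicator-inj fs fs-injective x j) (indicator-inj fs fs-injective x l))

starved-step : ∀ m {D D'} → Step (CycleG (suc m)) D D' → Starved m D → Starved m D'
starved-step m (fz , _ , _ , two , _) (empty , _) = contradiction (subst (2 ≤_) empty two) λ ()
starved-step m {D} (fs j , fz , adj , two , _) (_ , firstD , lastD) with root-neighbour m j adj
... | inj₁ j-first = ⊥-elim (<⇒≱ firstD (≤-trans
        (≤-reflexive (cong (2 *_) (sym (first-weight m j j-first))))
        (pebbles-weight (D ∘ fs) (wFirst m) j two)))
... | inj₂ j-last = ⊥-elim (<⇒≱ lastD (≤-trans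
        (≤-reflexive (cong (2 *_) (sym (last-weight m j j-last))))
        (pebbles-weight (D ∘ fs) (wLast m) j two)))
starved-step m {D} {D'} (fs j , fs l , adj , two , eq) (empty , firstD , lastD) =
  trans (eq fz) (trans (+-identityʳ (D fz)) empty) ,
  ≤-<-trans (decreases (wFirst m) (wFirst-potential m)) firstD ,
  ≤-<-trans (decreases (wLast m) (wLast-potential m)) lastD
  where
  decreases : ∀ w → Potential (PathG m) w → wsum (D' ∘ fs) w ≤ wsum (D ∘ fs) w
  decreases w pot = ≤-trans (≤-reflexive (wsum-cong w (tail-move j l eq)))
    (potential-move (D ∘ fs) j l w (pot j l (cycle-to-path m j l adj)) two)

starved-star : ∀ m {D X} → Star (Step (CycleG (suc m))) D X → Starved m D → Starved m X
starved-star m ε starved = starved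
starved-star m (step ◅ steps) starved = starved-star m steps (starved-step m step starved)

-- The rotation w ↦ w + 1 (mod k + 1) of C_{k+1}; every vertex is an
-- iterated rotation of the root, and rotation is an automorphism, so
-- reaching the root suffices.
shift-up : ∀ {k} → Fin (suc k) → Fin (suc (suc k))
shift-up fz = fz
shift-up (fs x) = fs (fs x)

rot : ∀ {k} → Fin (suc k) → Fin (suc k)
rot {zero} fz = fz
rot {suc k} fz = fs fz
rot {suc k} (fs w) = shift-up (rot w)

rot-next : ∀ {k} (w : Fin (suc k)) → Next (suc k) w (rot w)
rot-next {zero} fz = inj₂ (refl , refl)
rot-next {suc k} fz = inj₁ refl
rot-next {suc k} (fs w) = shift-next (rot w) (rot-next w)
  where
  shift-next : (z : Fin (suc k)) → Next (suc k) w z → Next (suc (suc k)) (fs w) (shift-up z)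
  shift-next fz (inj₁ ())
  shift-next fz (inj₂ (w-last , _)) = inj₂ (cong suc w-last , refl)
  shift-next (fs x) (inj₁ w→x) = inj₁ (cong suc w→x)
  shift-next (fs x) (inj₂ (_ , ()))

next-functional : ∀ {k} {a b c : Fin (suc k)} → Next (suc k) a b → Next (suc k) a c → b ≡ c
next-functional (inj₁ p) (inj₁ q) = toℕ-injective (trans (sym p) q)
next-functional {b = b} (inj₁ p) (inj₂ (q , _)) = ⊥-elim (<⇒≢ (toℕ<n b) (trans (sym p) q))
next-functional {c = c} (inj₂ (q , _)) (inj₁ p) = ⊥-elim (<⇒≢ (toℕ<n c) (trans (sym p) q))
next-functional (inj₂ (_ , p)) (inj₂ (_ , q)) = toℕ-injective (trans p (sym q))

next-injective : ∀ {k} {a b c : Fin (suc k)} → Next (suc k) a c → Next (suc k) b c → a ≡ b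
next-injective (inj₁ p) (inj₁ q) = toℕ-injective (suc-injective (trans p (sym q)))
next-injective (inj₁ p) (inj₂ (_ , q)) with () ← trans p q
next-injective (inj₂ (_ , q)) (inj₁ p) with () ← trans p q
next-injective (inj₂ (p , _)) (inj₂ (q , _)) = toℕ-injective (suc-injective (trans p (sym q)))

rot-injective : ∀ {k} (x y : Fin (suc k)) → rot x ≡ rot y → x ≡ y
rot-injective {k} x y eq = next-injective (rot-next x) (subst (Next (suc k) y) (sym eq) (rot-next y))

rot-automorphism : ∀ {k} (u v : Fin (suc k)) → CycleG (suc k) u v → CycleG (suc k) (rot u) (rot v)
rot-automorphism {k} u v (u≢v , inj₁ u→v) = (u≢v ∘ rot-injective u v) ,
  inj₁ (subst (Next (suc k) (rot u)) (cong rot (next-functional (rot-next u) u→v)) (rot-next (rot u)))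
rot-automorphism {k} u v (u≢v , inj₂ v→u) = (u≢v ∘ rot-injective u v) ,
  inj₂ (subst (Next (suc k) (rot v)) (cong rot (next-functional (rot-next v) v→u)) (rot-next (rot v)))

rot-inject₁ : ∀ {k} (r : Fin k) → rot (inject₁ r) ≡ fs r
rot-inject₁ r = next-functional (rot-next (inject₁ r)) (inj₁ (cong suc (toℕ-inject₁ r)))

size-rot : ∀ {k} (D : Dist (suc k)) → size (D ∘ rot) ≡ size D
size-rot {zero} D = refl
size-rot {suc k} D = begin
  size (D ∘ rot)                           ≡⟨ size-suc (D ∘ rot) ⟩
  D (fs fz) + size (D ∘ shift-up ∘ rot)    ≡⟨ cong (D (fs fz) +_) (size-rot (D ∘ shift-up)) ⟩
  D (fs fz) + size (D ∘ shift-up)          ≡⟨ cong (D (fs fz) +_) (size-suc (D ∘ shift-up)) ⟩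
  D (fs fz) + (D fz + size (D ∘ fs ∘ fs))  ≡⟨ swap (D (fs fz)) (D fz) _ ⟩
  D fz + (D (fs fz) + size (D ∘ fs ∘ fs))  ≡⟨ cong (D fz +_) (sym (size-suc (D ∘ fs))) ⟩
  D fz + size (D ∘ fs)                     ≡⟨ sym (size-suc D) ⟩
  size D                                   ∎
  where
  open ≡-Reasoning
  swap : ∀ a b c → a + (b + c) ≡ b + (a + c)
  swap = solve-∀

Reaches : ∀ k → ℕ → Fin (suc k) → Set
Reaches k N r = ∀ D → N ≤ size D → Reachable (CycleG (suc k)) D (δ r)

-- Reachability of r transfers to rot r: rotate the distribution back,
-- reach r, and transport the moves along the automorphism.
reaches-rot : ∀ {k N} r → Reaches k N r → Reaches k N (rot r)
reaches-rot {k} r reaches D N≤D with reaches (D ∘ rot) (≤-trans N≤D (≤-reflexive (sym (size-rot D))))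
... | X , steps , δ≤X
  with transport {G = CycleG (suc k)} rot rot-automorphism rot-injective D steps (λ _ → ≤-refl)
...   | D' , steps' , X≤D' , _ =
  D' , steps' , δ-below (rot r) D' (≤-trans (≤-reflexive (sym (δ-self r))) (≤-trans (δ≤X r) (X≤D' r)))

reaches-everywhere : ∀ {k N} → Reaches k N fz → ∀ r → Reaches k N r
reaches-everywhere {k} {N} root =
  <-weakInduction (Reaches k N) root λ r reaches → subst (Reaches k N) (rot-inject₁ r) (reaches-rot _ reaches)

cycle-number : ∀ m {N} → EndThreshold m 2 N → IsPebblingNumber (CycleG (suc m)) N
cycle-number m {N} (upper , E , sizeE , firstE , lastE) = sufficient , minimal
  where
  sufficient : PebProp (CycleG (suc m)) N
  sufficient D N≤D r =
    reaches-everywhere (root-reachable m (≤-trans (s≤s z≤n) (≤-reflexive sizeE)) upper) r D N≤D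
  E₀ : Dist (suc m)
  E₀ fz = 0
  E₀ (fs j) = E j
  unreachable : ¬ Reachable (CycleG (suc m)) E₀ (δ fz)
  unreachable (X , steps , δ≤X) with starved-star m steps (refl , firstE , lastE)
  ... | X-empty , _ = 1+n≰n (≤-trans (δ≤X fz) (≤-reflexive X-empty))
  minimal : ∀ M → PebProp (CycleG (suc m)) M → N ≤ M
  minimal M enough =
    below-witness E₀ (trans (cong suc (size-suc E₀)) sizeE) unreachable (λ D M≤D → enough D M≤D fz)

-- quot a q = ⌊2^a / 2^q⌋.
quot : ℕ → ℕ → ℕ
quot a zero = 2 ^ a
quot zero (suc q) = 0
quot (suc a) (suc q) = quot a q

quot-exact : ∀ q d → quot (q + d) q ≡ 2 ^ d
quot-exact zero d = refl
quot-exact (suc q) d = quot-exact q d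

quot-le : ∀ a q → 2 ^ q * quot a q ≤ 2 ^ a
quot-le a zero = ≤-reflexive (*-identityˡ _)
quot-le zero (suc q) = ≤-trans (≤-reflexive (*-zeroʳ (2 ^ suc q))) z≤n
quot-le (suc a) (suc q) = ≤-trans (≤-reflexive (*-assoc 2 (2 ^ q) (quot a q))) (*-monoʳ-≤ 2 (quot-le a q))

suc-≤-pow : ∀ n → suc n ≤ 2 ^ n
suc-≤-pow zero = ≤-refl
suc-≤-pow (suc n) = begin
  suc (suc n)       ≤⟨ s≤s (m≤n+m (suc n) n) ⟩
  suc n + suc n     ≤⟨ +-mono-≤ (suc-≤-pow n) (suc-≤-pow n) ⟩
  2 ^ n + 2 ^ n     ≡⟨ cong (2 ^ n +_) (sym (+-identityʳ (2 ^ n))) ⟩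
  2 * 2 ^ n         ∎
  where open ≤-Reasoning

-- Two exponents summing to r + 2q: after division by 2^q at least 2 + r
-- units survive.  This is the per-vertex count behind the upper bounds.
quot-sum : ∀ q r a b → a + b ≡ r + (q + q) → 2 + r ≤ quot a q + quot b q
quot-sum zero r a b a+b≡r = begin
  2 + r         ≡⟨ cong (2 +_) (sym (trans a+b≡r (+-identityʳ r))) ⟩
  2 + (a + b)   ≡⟨ cong suc (sym (+-suc a b)) ⟩
  suc a + suc b ≤⟨ +-mono-≤ (suc-≤-pow a) (suc-≤-pow b) ⟩
  2 ^ a + 2 ^ b ∎
  where open ≤-Reasoning
quot-sum (suc q) r zero b b≡ = begin
  2 + r                              ≤⟨ suc-≤-pow (suc r) ⟩
  2 ^ suc r                          ≤⟨ ^-monoʳ-≤ 2 (s≤s (m≤n+m r q)) ⟩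
  2 ^ (suc q + r)                    ≡⟨ sym (quot-exact (suc q) (suc q + r)) ⟩
  quot (suc q + (suc q + r)) (suc q) ≡⟨ cong (λ x → quot x (suc q)) (sym (trans b≡ (regroup r q))) ⟩
  quot b (suc q)                     ∎
  where
  open ≤-Reasoning
  regroup : ∀ r q → r + (suc q + suc q) ≡ suc q + (suc q + r)
  regroup = solve-∀
quot-sum (suc q) r (suc a) zero a≡ =
  ≤-trans (quot-sum (suc q) r zero (suc a) (trans (+-comm 0 (suc a)) a≡))
          (≤-reflexive (+-comm 0 (quot a q)))
quot-sum (suc q) r (suc a) (suc b) eq = quot-sum q r a b
  (suc-injective (suc-injective (trans (peel-left a b) (trans eq (peel-right r q)))))
  where
  peel-left : ∀ a b → suc (suc (a + b)) ≡ suc a + suc b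
  peel-left = solve-∀
  peel-right : ∀ r q → r + (suc q + suc q) ≡ suc (suc (r + (q + q)))
  peel-right = solve-∀

-- Dividing both weights of a
-- vertex by 2^q leaves at least 2 + r (quot-sum), while each scaled
-- potential stays below L.
scarce-count : ∀ q r (E : Dist (suc (r + (q + q)))) L →
  Φfirst E < 2 ^ q * L → Φlast E < 2 ^ q * L → (2 + r) * size E + 2 ≤ 2 * L
scarce-count q r E L firstE lastE = begin
  (2 + r) * size E + 2               ≡⟨ cong (λ s → (2 + r) * s + 2) (size-wsum E) ⟩
  (2 + r) * wsum E (λ _ → 1) + 2     ≡⟨ cong (_+ 2) (sym (wsum-scale E (2 + r) (λ _ → 1))) ⟩
  wsum E (λ _ → (2 + r) * 1) + 2     ≤⟨ +-monoˡ-≤ 2 (wsum-monoʷ E per-vertex) ⟩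
  wsum E (λ j → α j + β j) + 2       ≡⟨ cong (_+ 2) (wsum-+ʷ E α β) ⟩
  wsum E α + wsum E β + 2            ≡⟨ regroup (wsum E α) (wsum E β) ⟩
  suc (wsum E α) + suc (wsum E β)    ≤⟨ +-mono-≤ (scaled-below α α≤wFirst firstE) (scaled-below β β≤wLast lastE) ⟩
  L + L                              ≡⟨ cong (L +_) (sym (+-identityʳ L)) ⟩
  2 * L                              ∎
  where
  open ≤-Reasoning
  n₀ : ℕ
  n₀ = r + (q + q)
  α β : Fin (suc n₀) → ℕ
  α j = quot (n₀ ∸ toℕ j) q
  β j = quot (toℕ j) q
  regroup : ∀ x y → x + y + 2 ≡ suc x + suc y
  regroup = solve-∀
  per-vertex : ∀ j → (2 + r) * 1 ≤ α j + β j
  per-vertex j = ≤-trans (≤-reflexive (*-identityʳ (2 + r)))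
                         (quot-sum q r _ _ (m∸n+n≡m (≤-pred (toℕ<n j))))
  α≤wFirst : ∀ j → 2 ^ q * α j ≤ wFirst (suc n₀) j
  α≤wFirst j = ≤-trans (quot-le (n₀ ∸ toℕ j) q) (≤-reflexive (sym (wFirst-pow n₀ j)))
  β≤wLast : ∀ j → 2 ^ q * β j ≤ wLast (suc n₀) j
  β≤wLast j = ≤-trans (quot-le (toℕ j) q) (≤-reflexive (sym (wLast-pow (suc n₀) j)))
  scaled-below : ∀ γ {w : Fin (suc n₀) → ℕ} → (∀ j → 2 ^ q * γ j ≤ w j) →
    wsum E w < 2 ^ q * L → wsum E γ < L
  scaled-below γ {w} γ≤w w<L = *-cancelˡ-< (2 ^ q) (wsum E γ) L (≤-<-trans (begin
    2 ^ q * wsum E γ        ≡⟨ sym (wsum-scale E (2 ^ q) γ) ⟩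
    wsum E (λ j → 2 ^ q * γ j) ≤⟨ wsum-monoʷ E γ≤w ⟩
    wsum E w                ∎) w<L)

upper-from-count : ∀ n t N →
  (∀ (E : Dist n) → Φfirst E < t * 2 ^ (n ∸ 1) → Φlast E < t * 2 ^ (n ∸ 1) → size E < N) →
  EndUpper n t N
upper-from-count n t N count E N≤E with t * 2 ^ (n ∸ 1) ≤? Φfirst E | t * 2 ^ (n ∸ 1) ≤? Φlast E
... | yes first | _ = inj₁ first
... | no _ | yes last = inj₂ last
... | no first | no last = ⊥-elim (<⇒≱ (count E (≰⇒> first) (≰⇒> last)) N≤E)

size-·δ : ∀ {n} c (v : Fin n) → size (c ·δ v) ≡ c
size-·δ c v = trans (size-wsum (c ·δ v)) (trans (wsum-δ c v _) (*-identityʳ c))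

Φfirst-·δ : ∀ n₀ c (v : Fin (suc n₀)) → Φfirst (c ·δ v) ≡ c * 2 ^ (n₀ ∸ toℕ v)
Φfirst-·δ n₀ c v = trans (wsum-δ c v (wFirst (suc n₀))) (cong (c *_) (wFirst-pow n₀ v))

Φlast-·δ : ∀ n c (v : Fin n) → Φlast (c ·δ v) ≡ c * 2 ^ toℕ v
Φlast-·δ n c v = trans (wsum-δ c v (wLast n)) (cong (c *_) (wLast-pow n v))

pow-split : ∀ h i → 2 ^ i * 2 ^ (h + h) ≡ 2 ^ h * 2 ^ (h + i)
pow-split h i = begin
  2 ^ i * 2 ^ (h + h)     ≡⟨ cong (2 ^ i *_) (^-distribˡ-+-* 2 h h) ⟩
  2 ^ i * (2 ^ h * 2 ^ h) ≡⟨ *-comm-left (2 ^ i) (2 ^ h) (2 ^ h) ⟩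
  2 ^ h * (2 ^ i * 2 ^ h) ≡⟨ cong (2 ^ h *_) (*-comm (2 ^ i) (2 ^ h)) ⟩
  2 ^ h * (2 ^ h * 2 ^ i) ≡⟨ cong (2 ^ h *_) (sym (^-distribˡ-+-* 2 h i)) ⟩
  2 ^ h * 2 ^ (h + i)     ∎
  where open ≡-Reasoning

-- On P_{2h+1} the end threshold for 2^i pebbles is 2^(h+i); the witness
-- puts 2^(h+i) - 1 pebbles on the middle vertex x_{h+1}.
threshold-odd : ∀ h i → EndThreshold (suc (h + h)) (2 ^ i) (2 ^ (h + i))
threshold-odd h i = upper-from-count (suc (h + h)) (2 ^ i) L count , witness
  where
  L : ℕ
  L = 2 ^ (h + i)
  instance
    L-nonzero : NonZero L
    L-nonzero = m^n≢0 2 (h + i)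
  count : ∀ E → Φfirst E < 2 ^ i * 2 ^ (h + h) → Φlast E < 2 ^ i * 2 ^ (h + h) → size E < L
  count E firstE lastE = *-cancelˡ-≤ 2 (≤-trans (≤-reflexive (double-plus (size E)))
    (scarce-count h 0 E L (subst (Φfirst E <_) (pow-split h i) firstE)
                          (subst (Φlast E <_) (pow-split h i) lastE)))
    where
    double-plus : ∀ s → 2 * suc s ≡ 2 * s + 2
    double-plus = solve-∀
  mid : Fin (suc (h + h))
  mid = fromℕ< (s≤s (m≤m+n h h))
  toℕ-mid : toℕ mid ≡ h
  toℕ-mid = toℕ-fromℕ< (s≤s (m≤m+n h h))
  below : pred L * 2 ^ h < 2 ^ i * 2 ^ (h + h)
  below = ≤-trans (*-monoˡ-< (2 ^ h) {{m^n≢0 2 h}} (≤-reflexive (suc-pred L)))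
                  (≤-reflexive (trans (*-comm L (2 ^ h)) (sym (pow-split h i))))
  witness : EndWitness (suc (h + h)) (2 ^ i) L
  witness = pred L ·δ mid , trans (cong suc (size-·δ (pred L) mid)) (suc-pred L) ,
    ≤-<-trans (≤-reflexive first-value) below , ≤-<-trans (≤-reflexive last-value) below
    where
    first-value : Φfirst (pred L ·δ mid) ≡ pred L * 2 ^ h
    first-value = trans (Φfirst-·δ (h + h) (pred L) mid)
      (cong (λ k → pred L * 2 ^ k) (trans (cong (h + h ∸_) toℕ-mid) (m+n∸n≡m h h)))
    last-value : Φlast (pred L ·δ mid) ≡ pred L * 2 ^ h
    last-value = trans (Φlast-·δ _ (pred L) mid) (cong (λ k → pred L * 2 ^ k) toℕ-mid)

pow-mod3 : ∀ k → Σ ℕ λ P → 2 ^ k ≡ 3 * P + 1 ⊎ 2 ^ k ≡ 3 * P + 2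
pow-mod3 zero = 0 , inj₁ refl
pow-mod3 (suc k) with pow-mod3 k
... | P , inj₁ e = 2 * P , inj₂ (trans (cong (2 *_) e) (double-one P))
  where
  double-one : ∀ P → 2 * (3 * P + 1) ≡ 3 * (2 * P) + 2
  double-one = solve-∀
... | P , inj₂ e = suc (2 * P) , inj₁ (trans (cong (2 *_) e) (double-two P))
  where
  double-two : ∀ P → 2 * (3 * P + 2) ≡ 3 * suc (2 * P) + 1
  double-two = solve-∀

third : ℕ → ℕ
third k = proj₁ (pow-mod3 k)

third-bounds : ∀ k → 3 * third k < 2 ^ k × 2 ^ k ≤ 3 * third k + 2
third-bounds k with pow-mod3 k
... | P , inj₁ e = ≤-trans (≤-reflexive (+-comm 1 (3 * P))) (≤-reflexive (sym e)) ,
                   ≤-trans (≤-reflexive e) (+-monoʳ-≤ (3 * P) (s≤s z≤n))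
... | P , inj₂ e = ≤-trans (≤-reflexive (+-comm 1 (3 * P)))
                     (≤-trans (+-monoʳ-≤ (3 * P) (s≤s z≤n)) (≤-reflexive (sym e))) ,
                   ≤-reflexive e

size-+ : ∀ {n} (D E : Dist n) → size (λ w → D w + E w) ≡ size D + size E
size-+ D E = trans (size-wsum (λ w → D w + E w)) (trans (wsum-+ᵈ D E (λ _ → 1)) (sym (cong₂ _+_ (size-wsum D) (size-wsum E))))

-- On P_{2h+2} the end threshold for 2^i pebbles is 2⌊2^(h+i+1)/3⌋ + 1;
-- the witness puts ⌊2^(h+i+1)/3⌋ pebbles on each of the two middle
-- vertices x_{h+1}, x_{h+2}.
threshold-even : ∀ h i → EndThreshold (suc (suc (h + h))) (2 ^ i) (2 * third (suc (h + i)) + 1)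
threshold-even h i = upper-from-count (suc (suc (h + h))) (2 ^ i) (2 * P + 1) count , witness
  where
  L P M : ℕ
  L = 2 ^ suc (h + i)
  P = third (suc (h + i))
  M = 2 ^ i * 2 ^ suc (h + h)
  scale : M ≡ 2 ^ h * L
  scale = trans (*-comm-left (2 ^ i) 2 _)
          (trans (cong (2 *_) (pow-split h i)) (*-comm-left 2 (2 ^ h) _))
  count : ∀ E → Φfirst E < M → Φlast E < M → size E < 2 * P + 1
  count E firstE lastE = *-cancelˡ-< 3 (size E) (2 * P + 1) (+-cancelʳ-≤ 1 _ _ (begin
    suc (3 * size E) + 1 ≡⟨ sym (+-suc (3 * size E) 1) ⟩
    3 * size E + 2       ≤⟨ scarce-count h 1 E L (subst (Φfirst E <_) scale firstE)
                                                 (subst (Φlast E <_) scale lastE) ⟩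
    2 * L                ≤⟨ *-monoʳ-≤ 2 (proj₂ (third-bounds (suc (h + i)))) ⟩
    2 * (3 * P + 2)      ≡⟨ regroup P ⟩
    3 * (2 * P + 1) + 1  ∎))
    where
    open ≤-Reasoning
    regroup : ∀ P → 2 * (3 * P + 2) ≡ 3 * (2 * P + 1) + 1
    regroup = solve-∀
  lower upper : Fin (suc (suc (h + h)))
  lower = fromℕ< (s≤s (≤-trans (m≤m+n h h) (n≤1+n _)))
  upper = fromℕ< (s≤s (s≤s (m≤m+n h h)))
  toℕ-lower : toℕ lower ≡ h
  toℕ-lower = toℕ-fromℕ< (s≤s (≤-trans (m≤m+n h h) (n≤1+n _)))
  toℕ-upper : toℕ upper ≡ suc h
  toℕ-upper = toℕ-fromℕ< (s≤s (s≤s (m≤m+n h h)))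
  E : Dist (suc (suc (h + h)))
  E w = (P ·δ lower) w + (P ·δ upper) w
  below : P * 2 ^ suc h + P * 2 ^ h < M
  below = ≤-trans (≤-trans (≤-reflexive (cong suc (three-halves P (2 ^ h))))
                           (*-monoʳ-< (2 ^ h) {{m^n≢0 2 h}} (proj₁ (third-bounds (suc (h + i))))))
                  (≤-reflexive (sym scale))
    where
    three-halves : ∀ P x → P * (2 * x) + P * x ≡ x * (3 * P)
    three-halves = solve-∀
  first-value : Φfirst E ≡ P * 2 ^ suc h + P * 2 ^ h
  first-value = trans (wsum-+ᵈ (P ·δ lower) (P ·δ upper) (wFirst (suc (suc (h + h))))) (cong₂ _+_
    (trans (Φfirst-·δ _ P lower) (cong (λ k → P * 2 ^ k) (trans (cong (suc (h + h) ∸_) toℕ-lower) (m+n∸n≡m (suc h) h))))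
    (trans (Φfirst-·δ _ P upper) (cong (λ k → P * 2 ^ k) (trans (cong (suc (h + h) ∸_) toℕ-upper) (m+n∸n≡m h h)))))
  last-value : Φlast E ≡ P * 2 ^ suc h + P * 2 ^ h
  last-value = trans (wsum-+ᵈ (P ·δ lower) (P ·δ upper) (wLast (suc (suc (h + h))))) (trans (cong₂ _+_
    (trans (Φlast-·δ _ P lower) (cong (λ k → P * 2 ^ k) toℕ-lower))
    (trans (Φlast-·δ _ P upper) (cong (λ k → P * 2 ^ k) toℕ-upper))) (+-comm (P * 2 ^ h) _))
  witness : EndWitness (suc (suc (h + h))) (2 ^ i) (2 * P + 1)
  witness = E ,
    trans (cong suc (trans (size-+ (P ·δ lower) (P ·δ upper)) (cong₂ _+_ (size-·δ P lower) (size-·δ P upper))))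
          (twice P) ,
    ≤-<-trans (≤-reflexive first-value) below , ≤-<-trans (≤-reflexive last-value) below
    where
    twice : ∀ P → suc (P + P) ≡ 2 * P + 1
    twice = solve-∀

threshold-empty : ∀ t → 1 ≤ t → EndThreshold 0 t 1
threshold-empty t t≥1 = (λ E ()) , (λ ()) , refl , t*1≥1 , t*1≥1
  where
  t*1≥1 : 0 < t * 1
  t*1≥1 = ≤-trans t≥1 (≤-reflexive (sym (*-identityʳ t)))

cycle-length-cong : ∀ {m m' N} → m ≡ m' → IsPebblingNumber (CycleG m) N → IsPebblingNumber (CycleG m') N
cycle-length-cong refl π≡N = π≡N

cycle-even-length : ∀ k → IsPebblingNumber (CycleG (suc (suc (k + k)))) (2 ^ suc k)
cycle-even-length k =
  cycle-number (suc (k + k)) (subst (EndThreshold (suc (k + k)) 2) (cong (2 ^_) (+-comm k 1)) (threshold-odd k 1))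

cycle-odd-length : ∀ k → IsPebblingNumber (CycleG (suc (k + k))) (2 * third (suc k) + 1)
cycle-odd-length zero = cycle-number 0 (threshold-empty 2 (s≤s z≤n))
cycle-odd-length (suc k) =
  cycle-length-cong (cong (suc ∘ suc) (sym (+-suc k k)))
    (cycle-number (suc (suc (k + k)))
      (subst (λ e → EndThreshold (suc (suc (k + k))) 2 (2 * third e + 1)) (cong suc (+-comm k 1)) (threshold-even k 1)))

data PathLength : ℕ → Set where
  odd-length  : ∀ h → PathLength (suc (h + h))
  even-length : ∀ h → PathLength (suc (suc (h + h)))

path-length : ∀ n → PathLength (suc n)
path-length zero = odd-length 0
path-length (suc n) with path-length n
... | odd-length h = even-length h
... | even-length h = subst PathLength (cong (suc ∘ suc) (+-suc h h)) (odd-length (suc h))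

proposition4p8 : (n i : ℕ) → (h : 2 ≤ n) →
    Σ ℕ λ N → IsTSPebblingNumber (PathG n) (EndTargets n i h) N
              × IsPebblingNumber (CycleG (n + 2 * i ∸ 1)) N
proposition4p8 (suc n₀) i h with path-length n₀
... | odd-length zero with s≤s () ← h
... | odd-length (suc g) =
  2 ^ (suc g + i) , path-number (suc g + suc g) i h (threshold-odd (suc g) i) ,
  cycle-length-cong (odd-cycle g i) (cycle-even-length (g + i))
  where
  odd-cycle : ∀ g i → suc (suc ((g + i) + (g + i))) ≡ suc g + suc g + 2 * i
  odd-cycle = solve-∀
... | even-length g =
  2 * third (suc (g + i)) + 1 , path-number (suc (g + g)) i h (threshold-even g i) ,
  cycle-length-cong (even-cycle g i) (cycle-odd-length (g + i))
  where
  even-cycle : ∀ g i → suc ((g + i) + (g + i)) ≡ suc (g + g) + 2 * i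
  even-cycle = solve-∀
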